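{- Let $P,P'$ and $Q[X]$ be queries of the game $\mathsf{NB}$ over a set of extension axioms $\mathcal{E}$, where $X$ is a distinguished single subquery occurrence in $Q[X]$, and let $b,c\in\{0,1\}$. From the state $\{P\mapsto b,\ P'\mapsto b,\ Q[P]\mapsto c,\ Q[P']\mapsto 1-c\}$ there is a winning strategy in $\mathsf{NB}$ with $O(\log(\mathrm{depth}(Q[X])))$ rounds. The same holds with $\mathsf{NB}$ replaced by $\mathsf{NB}^{\mathrm{DM}}$ throughout (all queries being $\mathsf{NB}^{\mathrm{DM}}$ queries).
   Context: eNDT formulas: $A::=0\mid1\mid ApB\mid A\lor B\mid e_i$ ($p$ propositional variable, $e_i$ extension variables; $ApB$ means "if $p$ then $B$ else $A$"; $p$ is identified with $0p1$). A set of extension axioms $\mathcal{E}=\{e_i\leftrightarrow E_i\}_{i<n}$ with $E_i$ mentioning only $e_0,\dots,e_{i-1}$. Simulation $A\succeq_\mathcal{E}B$: smallest relation with $A\succeq A$; $A\succeq C,A\succeq D\Rightarrow A\succeq C\lor D$; $A\succeq E_i\Rightarrow A\succeq e_i$; $A\succeq C,B\succeq D\Rightarrow ApB\succeq CpD$; $A_j\succeq B\Rightarrow A_0\lor A_1\succeq B$; $E_i\succeq B\Rightarrow e_i\succeq B$. Game $\mathsf{NB}$ over $\mathcal{E}$: queries $Q::=A\mid\neg Q\mid Q\lor R\mid Q\land R$ ($A$ eNDT). Simple contradictions: $\{0\mapsto1\}$, $\{1\mapsto0\}$; $\{A_0\mapsto b_0,A_1\mapsto b_1,p\mapsto i,A_0pA_1\mapsto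 c\}$ with $c\ne b_i$; sets inconsistent with the truth tables of $\neg,\lor,\land$ ($\{Q\mapsto b,\neg Q\mapsto b\}$, $\{Q_0\lor Q_1\mapsto0,Q_i\mapsto1\}$, $\{Q_0\lor Q_1\mapsto1,Q_0\mapsto0,Q_1\mapsto0\}$, $\{Q_0\land Q_1\mapsto0,Q_0\mapsto1,Q_1\mapsto1\}$, $\{Q_0\land Q_1\mapsto1,Q_i\mapsto0\}$); $\{e_i\mapsto b,E_i\mapsto1-b\}$; $\{A\mapsto0,B\mapsto1\}$ whenever $A\succeq_\mathcal{E}B$. $\mathsf{NB}^{\mathrm{DM}}$ is the restriction of $\mathsf{NB}$ to De Morgan queries $Q::=A\mid\neg A\mid Q\lor R\mid Q\land R$ ($A$ eNDT), with the simple contradictions of $\mathsf{NB}$ among such queries. A winning strategy from a state $S$ (set of Boolean assignments to queries) is a finite binary tree with internal nodes labelled by queries and outgoing edges labelled $0,1$ such that along every root-to-leaf path $S$ plus the assignments made contains a simple contradiction; rounds = depth. $\mathrm{depth}(Q)$ is the maximum length of a path in the formula tree of $Q$ from the root to a maximal eNDT subformula (Boolean connectives $\neg,\lor,\land$ above the eNDT subformulas). $Q[P]$ denotes $Q[X]$ with the occurrence $X$ replaced by $P$. -}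

module Defs where

open import Data.Nat using (ℕ; zero; suc; _+_; _*_; _≤_; _⊔_)
open import Data.Nat.Properties using (<⇒≤)
open import Data.Nat.Logarithm using (⌈log₂_⌉)
open import Data.Bool using (Bool; true; false; not; if_then_else_)
open import Data.Fin using (Fin; toℕ; inject≤)
open import Data.Fin.Properties using (toℕ<n)
open import Data.List using (List; _∷_)
open import Data.List.Membership.Propositional using (_∈_)
open import Data.Product using (_×_; _,_; Σ; ∃)
open import Relation.Binary.PropositionalEquality using (_≢_)

-- eNDT formulas with n extension variables e_0,…,e_{n-1}
-- and propositional variables indexed by ℕ.
-- ite A p B  is  "ApB" = if p then B else A.

data Form (n : ℕ) : Set where
  𝟘 𝟙  : Form n
  ite  : Form n → ℕ → Form n → Form n
  _∨_  : Form n → Form n → Form n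
  ext  : Fin n → Form n

var : ∀ {n} → ℕ → Form n
var p = ite 𝟘 p 𝟙

weaken : ∀ {m n} → m ≤ n → Form m → Form n
weaken le 𝟘 = 𝟘
weaken le 𝟙 = 𝟙
weaken le (ite A p B) = ite (weaken le A) p (weaken le B)
weaken le (A ∨ B) = weaken le A ∨ weaken le B
weaken le (ext i) = ext (inject≤ i le)

-- A set of extension axioms {e_i ↔ E_i}_{i<n}: E_i mentions only e_0..e_{i-1}.
Ext : ℕ → Set
Ext n = (i : Fin n) → Form (toℕ i)

ax : ∀ {n} → Ext n → Fin n → Form n
ax E i = weaken (<⇒≤ (toℕ<n i)) (E i)

data Sim {n : ℕ} (E : Ext n) : Form n → Form n → Set where
  sim-refl : ∀ {A} → Sim E A A
  sim-∨r   : ∀ {A C D} → Sim E A C → Sim E A D → Sim E A (C ∨ D)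
  sim-extr : ∀ {A i} → Sim E A (ax E i) → Sim E A (ext i)
  sim-ite  : ∀ {A B C D p} → Sim E A C → Sim E B D → Sim E (ite A p B) (ite C p D)
  sim-∨l₀  : ∀ {A₀ A₁ B} → Sim E A₀ B → Sim E (A₀ ∨ A₁) B
  sim-∨l₁  : ∀ {A₀ A₁ B} → Sim E A₁ B → Sim E (A₀ ∨ A₁) B
  sim-extl : ∀ {i B} → Sim E (ax E i) B → Sim E (ext i) B

data Query (n : ℕ) : Set where
  atom : Form n → Query n
  ¬q   : Query n → Query n
  _∨q_ : Query n → Query n → Query n
  _∧q_ : Query n → Query n → Query n

data IsDM {n : ℕ} : Query n → Set where
  dm-atom : ∀ {A} → IsDM (atom A)
  dm-neg  : ∀ {A} → IsDM (¬q (atom A))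
  dm-∨    : ∀ {Q R} → IsDM Q → IsDM R → IsDM (Q ∨q R)
  dm-∧    : ∀ {Q R} → IsDM Q → IsDM R → IsDM (Q ∧q R)

depth : ∀ {n} → Query n → ℕ
depth (atom A) = 0
depth (¬q Q) = suc (depth Q)
depth (Q ∨q R) = suc (depth Q ⊔ depth R)
depth (Q ∧q R) = suc (depth Q ⊔ depth R)

data Ctx (n : ℕ) : Set where
  hole : Ctx n
  ¬c   : Ctx n → Ctx n
  ∨cl  : Ctx n → Query n → Ctx n
  ∨cr  : Query n → Ctx n → Ctx n
  ∧cl  : Ctx n → Query n → Ctx n
  ∧cr  : Query n → Ctx n → Ctx n

plug : ∀ {n} → Ctx n → Query n → Query n
plug hole P = P
plug (¬c K) P = ¬q (plug K P)
plug (∨cl K R) P = plug K P ∨q R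
plug (∨cr R K) P = R ∨q plug K P
plug (∧cl K R) P = plug K P ∧q R
plug (∧cr R K) P = R ∧q plug K P

-- States and simple contradictions (false = 0, true = 1)

State : ℕ → Set
State n = List (Query n × Bool)

data HasContra {n : ℕ} (E : Ext n) (S : State n) : Set where
  c-0↦1 : (atom 𝟘 , true) ∈ S → HasContra E S
  c-1↦0 : (atom 𝟙 , false) ∈ S → HasContra E S
  c-ite : ∀ {A₀ A₁ p b₀ b₁ i c} →
          (atom A₀ , b₀) ∈ S → (atom A₁ , b₁) ∈ S →
          (atom (var p) , i) ∈ S → (atom (ite A₀ p A₁) , c) ∈ S →
          c ≢ (if i then b₁ else b₀) → HasContra E S
  c-¬   : ∀ {Q b} → (Q , b) ∈ S → (¬q Q , b) ∈ S → HasContra E S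
  c-∨0₀ : ∀ {Q₀ Q₁} → (Q₀ ∨q Q₁ , false) ∈ S → (Q₀ , true) ∈ S → HasContra E S
  c-∨0₁ : ∀ {Q₀ Q₁} → (Q₀ ∨q Q₁ , false) ∈ S → (Q₁ , true) ∈ S → HasContra E S
  c-∨1  : ∀ {Q₀ Q₁} → (Q₀ ∨q Q₁ , true) ∈ S → (Q₀ , false) ∈ S →
          (Q₁ , false) ∈ S → HasContra E S
  c-∧0  : ∀ {Q₀ Q₁} → (Q₀ ∧q Q₁ , false) ∈ S → (Q₀ , true) ∈ S →
          (Q₁ , true) ∈ S → HasContra E S
  c-∧1₀ : ∀ {Q₀ Q₁} → (Q₀ ∧q Q₁ , true) ∈ S → (Q₀ , false) ∈ S → HasContra E S
  c-∧1₁ : ∀ {Q₀ Q₁} → (Q₀ ∧q Q₁ , true) ∈ S → (Q₁ , false) ∈ S → HasContra E S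
  c-ext : ∀ {i b} → (atom (ext i) , b) ∈ S → (atom (ax E i) , not b) ∈ S →
          HasContra E S
  c-sim : ∀ {A B} → (atom A , false) ∈ S → (atom B , true) ∈ S →
          Sim E A B → HasContra E S

-- Strategies: binary trees, internal nodes labelled by queries;
-- first subtree = answer 0, second = answer 1.

data Strategy (n : ℕ) : Set where
  leaf : Strategy n
  node : Query n → Strategy n → Strategy n → Strategy n

rounds : ∀ {n} → Strategy n → ℕ
rounds leaf = 0
rounds (node Q t₀ t₁) = suc (rounds t₀ ⊔ rounds t₁)

data Wins {n : ℕ} (E : Ext n) : State n → Strategy n → Set where
  win-leaf : ∀ {S} → HasContra E S → Wins E S leaf
  win-node : ∀ {S Q t₀ t₁} → Wins E ((Q , false) ∷ S) t₀ →
             Wins E ((Q , true) ∷ S) t₁ → Wins E S (node Q t₀ t₁)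

data AllDM {n : ℕ} : Strategy n → Set where
  dm-leaf : AllDM leaf
  dm-node : ∀ {Q t₀ t₁} → IsDM Q → AllDM t₀ → AllDM t₁ → AllDM (node Q t₀ t₁)

initState : ∀ {n} → Query n → Query n → Ctx n → Bool → Bool → State n
initState P P′ K b c =
  (P , b) ∷ (P′ , b) ∷ (plug K P , c) ∷ (plug K P′ , not c) ∷ Data.List.[]

{-# OPTIONS --safe #-}
-- Write Q[X] as a stack of d ≤ depth(Q[X]) one-connective frames and binary-search for the
-- frame at which the values of Q[P] and Q[P′] start to differ.  Splitting the stack as
-- K₁[K₂[X]], ask K₂[P] and K₂[P′]: if they get the same value, K₁[K₂[P]] and K₁[K₂[P′]]
-- still disagree and we continue in K₁ with K₂[P], K₂[P′] in place of P, P′; otherwise we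
-- continue in K₂.  After ⌈log₂ d⌉ halvings (two rounds each) at most one frame F is left.
-- With P ↦ a, P′ ↦ a, F[P] ↦ c, F[P′] ↦ 1-c, asking the other argument of F makes one of
-- F[P], F[P′] violate a truth table; with no frame left, P or P′ has received both values.
-- Every query asked is a subquery of Q[P] or Q[P′], so De Morgan queries suffice when these
-- are De Morgan.
module Submission where

open import Defs hiding (_∨_)
open import Data.Nat using (ℕ; zero; suc; _+_; _*_; _^_; _≤_; z≤n; s≤s; ⌊_/2⌋; ⌈_/2⌉)
open import Data.Nat.Properties
open import Data.Nat.Logarithm using (⌈log₂_⌉; ⌈log₂⌈n/2⌉⌉≡⌈log₂n⌉∸1)
open import Data.Bool using (Bool; true; false; not; _∧_; _∨_; if_then_else_)
open import Data.Bool.Properties using (¬-not) renaming (_≟_ to _≟ᵇ_)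
open import Data.Product using (_×_; _,_; Σ; ∃)
open import Data.Sum using (_⊎_; inj₁; inj₂; [_,_]′)
open import Data.List using (List; []; _∷_; _++_; length; foldr; take; drop)
open import Data.List.Properties using (foldr-++; take++drop≡id; length-take; length-drop)
open import Data.List.Membership.Propositional using (_∈_)
open import Data.List.Relation.Unary.Any using (here; there)
open import Relation.Nullary using (does; yes; no; contradiction)
open import Relation.Binary.PropositionalEquality

private
  variable
    n : ℕ
    E : Ext n
    S : State n
    P P′ Q Q′ Q₀ Q₁ : Query n
    a b c u v x z : Bool

⌈log₂n⌉≤k⇒n≤2^k : ∀ k n → ⌈log₂ n ⌉ ≤ k → n ≤ 2 ^ k
⌈log₂n⌉≤k⇒n≤2^k k       0             _ = z≤n
⌈log₂n⌉≤k⇒n≤2^k k       1             _ = m^n>0 2 k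
⌈log₂n⌉≤k⇒n≤2^k zero    (suc (suc n)) ()
⌈log₂n⌉≤k⇒n≤2^k (suc k) n@(suc (suc _)) ⌈log₂n⌉≤1+k = begin
  n                      ≡⟨ ⌊n/2⌋+⌈n/2⌉≡n n ⟨
  ⌊ n /2⌋ + ⌈ n /2⌉      ≤⟨ +-monoˡ-≤ ⌈ n /2⌉ (⌊n/2⌋≤⌈n/2⌉ n) ⟩
  ⌈ n /2⌉ + ⌈ n /2⌉      ≤⟨ +-mono-≤ half≤2^k (m≤m+n ⌈ n /2⌉ 0) ⟩
  2 ^ k + (⌈ n /2⌉ + 0)  ≤⟨ +-monoʳ-≤ (2 ^ k) (+-monoˡ-≤ 0 half≤2^k) ⟩
  2 ^ suc k              ∎
  where
  open ≤-Reasoning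
  half≤2^k : ⌈ n /2⌉ ≤ 2 ^ k
  half≤2^k = ⌈log₂n⌉≤k⇒n≤2^k k ⌈ n /2⌉
    (subst (_≤ k) (sym (⌈log₂⌈n/2⌉⌉≡⌈log₂n⌉∸1 n)) (∸-monoˡ-≤ 1 ⌈log₂n⌉≤1+k))

n≤2^⌈log₂n⌉ : ∀ n → n ≤ 2 ^ ⌈log₂ n ⌉
n≤2^⌈log₂n⌉ n = ⌈log₂n⌉≤k⇒n≤2^k ⌈log₂ n ⌉ n ≤-refl

≢⊎not≢ : ∀ x y → x ≢ y ⊎ not x ≢ y
≢⊎not≢ false false = inj₂ λ ()
≢⊎not≢ false true  = inj₁ λ ()
≢⊎not≢ true  false = inj₁ λ ()
≢⊎not≢ true  true  = inj₂ λ ()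

data Frame (n : ℕ) : Set where
  ¬□              : Frame n
  □∨_ _∨□ □∧_ _∧□ : Query n → Frame n

_⟨_⟩ : Frame n → Query n → Query n
¬□     ⟨ Q ⟩ = ¬q Q
(□∨ R) ⟨ Q ⟩ = Q ∨q R
(R ∨□) ⟨ Q ⟩ = R ∨q Q
(□∧ R) ⟨ Q ⟩ = Q ∧q R
(R ∧□) ⟨ Q ⟩ = R ∧q Q

fill : List (Frame n) → Query n → Query n
fill fs Q = foldr _⟨_⟩ Q fs

fill-take-drop : ∀ m (fs : List (Frame n)) Q → fill fs Q ≡ fill (take m fs) (fill (drop m fs) Q)
fill-take-drop m fs Q = begin
  fill fs Q                              ≡⟨ cong (λ gs → fill gs Q) (take++drop≡id m fs) ⟨
  foldr _⟨_⟩ Q (take m fs ++ drop m fs)  ≡⟨ foldr-++ _⟨_⟩ Q (take m fs) (drop m fs) ⟩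
  fill (take m fs) (fill (drop m fs) Q)  ∎
  where open ≡-Reasoning

frames : Ctx n → List (Frame n)
frames hole      = []
frames (¬c K)    = ¬□ ∷ frames K
frames (∨cl K R) = □∨ R ∷ frames K
frames (∨cr R K) = R ∨□ ∷ frames K
frames (∧cl K R) = □∧ R ∷ frames K
frames (∧cr R K) = R ∧□ ∷ frames K

plug≡fill-frames : ∀ (K : Ctx n) Q → plug K Q ≡ fill (frames K) Q
plug≡fill-frames hole      Q = refl
plug≡fill-frames (¬c K)    Q = cong ¬q (plug≡fill-frames K Q)
plug≡fill-frames (∨cl K R) Q = cong (_∨q R) (plug≡fill-frames K Q)
plug≡fill-frames (∨cr R K) Q = cong (R ∨q_) (plug≡fill-frames K Q)
plug≡fill-frames (∧cl K R) Q = cong (_∧q R) (plug≡fill-frames K Q)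
plug≡fill-frames (∧cr R K) Q = cong (R ∧q_) (plug≡fill-frames K Q)

length-frames≤depth : ∀ (K : Ctx n) X → length (frames K) ≤ depth (plug K X)
length-frames≤depth hole      X = z≤n
length-frames≤depth (¬c K)    X = s≤s (length-frames≤depth K X)
length-frames≤depth (∨cl K R) X = s≤s (≤-trans (length-frames≤depth K X) (m≤m⊔n _ _))
length-frames≤depth (∨cr R K) X = s≤s (≤-trans (length-frames≤depth K X) (m≤n⊔m _ _))
length-frames≤depth (∧cl K R) X = s≤s (≤-trans (length-frames≤depth K X) (m≤m⊔n _ _))
length-frames≤depth (∧cr R K) X = s≤s (≤-trans (length-frames≤depth K X) (m≤n⊔m _ _))

IsDM-⟨⟩⁻ : ∀ (f : Frame n) → IsDM (f ⟨ Q ⟩) → IsDM Q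
IsDM-⟨⟩⁻ ¬□     dm-neg      = dm-atom
IsDM-⟨⟩⁻ (□∨ R) (dm-∨ d _)  = d
IsDM-⟨⟩⁻ (R ∨□) (dm-∨ _ d)  = d
IsDM-⟨⟩⁻ (□∧ R) (dm-∧ d _)  = d
IsDM-⟨⟩⁻ (R ∧□) (dm-∧ _ d)  = d

IsDM-fill⁻ : ∀ (fs : List (Frame n)) → IsDM (fill fs Q) → IsDM Q
IsDM-fill⁻ []       d = d
IsDM-fill⁻ (f ∷ fs) d = IsDM-fill⁻ fs (IsDM-⟨⟩⁻ f d)

¬-contra : (¬q Q , z) ∈ S → (Q , u) ∈ S → z ≢ not u → HasContra E S
¬-contra {z = false} {u = false} m¬ m _   = c-¬ m m¬
¬-contra {z = true}  {u = true}  m¬ m _   = c-¬ m m¬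
¬-contra {z = false} {u = true}  _  _ z≢ = contradiction refl z≢
¬-contra {z = true}  {u = false} _  _ z≢ = contradiction refl z≢

∨-contra : (Q₀ ∨q Q₁ , z) ∈ S → (Q₀ , u) ∈ S → (Q₁ , v) ∈ S → z ≢ u ∨ v → HasContra E S
∨-contra {z = false} {u = true}              m m₀ _  _  = c-∨0₀ m m₀
∨-contra {z = false} {u = false} {v = true}  m _  m₁ _  = c-∨0₁ m m₁
∨-contra {z = true}  {u = false} {v = false} m m₀ m₁ _  = c-∨1 m m₀ m₁
∨-contra {z = false} {u = false} {v = false} _ _  _  z≢ = contradiction refl z≢
∨-contra {z = true}  {u = false} {v = true}  _ _  _  z≢ = contradiction refl z≢
∨-contra {z = true}  {u = true}              _ _  _  z≢ = contradiction refl z≢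

∧-contra : (Q₀ ∧q Q₁ , z) ∈ S → (Q₀ , u) ∈ S → (Q₁ , v) ∈ S → z ≢ u ∧ v → HasContra E S
∧-contra {z = true}  {u = false}             m m₀ _  _  = c-∧1₀ m m₀
∧-contra {z = true}  {u = true}  {v = false} m _  m₁ _  = c-∧1₁ m m₁
∧-contra {z = false} {u = true}  {v = true}  m m₀ m₁ _  = c-∧0 m m₀ m₁
∧-contra {z = true}  {u = true}  {v = true}  _ _  _  z≢ = contradiction refl z≢
∧-contra {z = false} {u = true}  {v = false} _ _  _  z≢ = contradiction refl z≢
∧-contra {z = false} {u = false}             _ _  _  z≢ = contradiction refl z≢

ask : Query n → Strategy n → Strategy n
ask Q t = node Q t t

ask-wins : ∀ {t} → (∀ r → Wins E ((Q , r) ∷ S) t) → Wins E S (ask Q t)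
ask-wins w = win-node (w false) (w true)

refuteBoth : Query n → Strategy n
refuteBoth (atom A)   = leaf
refuteBoth (¬q Q)     = ask Q leaf
refuteBoth (Q₀ ∨q Q₁) = ask Q₀ (ask Q₁ leaf)
refuteBoth (Q₀ ∧q Q₁) = ask Q₀ (ask Q₁ leaf)

refuteBoth-wins : ∀ Q {b} → (Q , b) ∈ S → (Q , not b) ∈ S → Wins E S (refuteBoth Q)
refuteBoth-wins (atom A) {false} m m′ = win-leaf (c-sim m m′ sim-refl)
refuteBoth-wins (atom A) {true}  m m′ = win-leaf (c-sim m′ m sim-refl)
refuteBoth-wins (¬q Q) {b} m m′ = ask-wins λ r → win-leaf
  ([ ¬-contra (there m) (here refl) , ¬-contra (there m′) (here refl) ]′ (≢⊎not≢ b (not r)))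
refuteBoth-wins (Q₀ ∨q Q₁) {b} m m′ = ask-wins λ r₀ → ask-wins λ r₁ → win-leaf
  ([ ∨-contra (there (there m)) (there (here refl)) (here refl)
   , ∨-contra (there (there m′)) (there (here refl)) (here refl) ]′ (≢⊎not≢ b (r₀ ∨ r₁)))
refuteBoth-wins (Q₀ ∧q Q₁) {b} m m′ = ask-wins λ r₀ → ask-wins λ r₁ → win-leaf
  ([ ∧-contra (there (there m)) (there (here refl)) (here refl)
   , ∧-contra (there (there m′)) (there (here refl)) (here refl) ]′ (≢⊎not≢ b (r₀ ∧ r₁)))

refuteBoth-rounds : ∀ (Q : Query n) → rounds (refuteBoth Q) ≤ 2
refuteBoth-rounds (atom A)   = z≤n
refuteBoth-rounds (¬q Q)     = s≤s z≤n
refuteBoth-rounds (Q₀ ∨q Q₁) = ≤-refl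
refuteBoth-rounds (Q₀ ∧q Q₁) = ≤-refl

refuteBoth-DM : IsDM Q → AllDM (refuteBoth Q)
refuteBoth-DM dm-atom     = dm-leaf
refuteBoth-DM dm-neg      = dm-node dm-atom dm-leaf dm-leaf
refuteBoth-DM (dm-∨ d e)  = dm-node d (dm-node e dm-leaf dm-leaf) (dm-node e dm-leaf dm-leaf)
refuteBoth-DM (dm-∧ d e)  = dm-node d (dm-node e dm-leaf dm-leaf) (dm-node e dm-leaf dm-leaf)

askSide : Frame n → Strategy n
askSide ¬□     = leaf
askSide (□∨ R) = ask R leaf
askSide (R ∨□) = ask R leaf
askSide (□∧ R) = ask R leaf
askSide (R ∧□) = ask R leaf

askSide-wins : ∀ f → (Q , u) ∈ S → (Q′ , u) ∈ S → (f ⟨ Q ⟩ , z) ∈ S → (f ⟨ Q′ ⟩ , not z) ∈ S →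
               Wins E S (askSide f)
askSide-wins {u = u} {z = z} ¬□ m m′ mf mf′ = win-leaf
  ([ ¬-contra mf m , ¬-contra mf′ m′ ]′ (≢⊎not≢ z (not u)))
askSide-wins {u = u} {z = z} (□∨ R) m m′ mf mf′ = ask-wins λ r → win-leaf
  ([ ∨-contra (there mf) (there m) (here refl)
   , ∨-contra (there mf′) (there m′) (here refl) ]′ (≢⊎not≢ z (u ∨ r)))
askSide-wins {u = u} {z = z} (R ∨□) m m′ mf mf′ = ask-wins λ r → win-leaf
  ([ ∨-contra (there mf) (here refl) (there m)
   , ∨-contra (there mf′) (here refl) (there m′) ]′ (≢⊎not≢ z (r ∨ u)))
askSide-wins {u = u} {z = z} (□∧ R) m m′ mf mf′ = ask-wins λ r → win-leaf
  ([ ∧-contra (there mf) (there m) (here refl)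
   , ∧-contra (there mf′) (there m′) (here refl) ]′ (≢⊎not≢ z (u ∧ r)))
askSide-wins {u = u} {z = z} (R ∧□) m m′ mf mf′ = ask-wins λ r → win-leaf
  ([ ∧-contra (there mf) (here refl) (there m)
   , ∧-contra (there mf′) (here refl) (there m′) ]′ (≢⊎not≢ z (r ∧ u)))

askSide-rounds : ∀ (f : Frame n) → rounds (askSide f) ≤ 1
askSide-rounds ¬□     = z≤n
askSide-rounds (□∨ R) = ≤-refl
askSide-rounds (R ∨□) = ≤-refl
askSide-rounds (□∧ R) = ≤-refl
askSide-rounds (R ∧□) = ≤-refl

askSide-DM : ∀ f → IsDM (f ⟨ Q ⟩) → AllDM (askSide f)
askSide-DM ¬□     _          = dm-leaf
askSide-DM (□∨ R) (dm-∨ _ d) = dm-node d dm-leaf dm-leaf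
askSide-DM (R ∨□) (dm-∨ d _) = dm-node d dm-leaf dm-leaf
askSide-DM (□∧ R) (dm-∧ _ d) = dm-node d dm-leaf dm-leaf
askSide-DM (R ∧□) (dm-∧ d _) = dm-node d dm-leaf dm-leaf

bisect : ℕ → List (Frame n) → Query n → Query n → Bool → Bool → Strategy n
bisect zero    []      P P′ a x = if does (x ≟ᵇ a) then refuteBoth P′ else refuteBoth P
-- For k = 0 only lists of length ≤ 1 matter; longer ones get an arbitrary strategy.
bisect zero    (f ∷ _) P P′ a x = askSide f
bisect (suc k) fs      P P′ a x =
  node M (node M′ (bisect k ys M M′ false x) (bisect k zs P P′ a false))
         (node M′ (bisect k zs P P′ a true)  (bisect k ys M M′ true x))
  where
  ys = take (2 ^ k) fs
  zs = drop (2 ^ k) fs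
  M  = fill zs P
  M′ = fill zs P′

bisect-wins : ∀ k (fs : List (Frame n)) → length fs ≤ 2 ^ k →
              (P , a) ∈ S → (P′ , a) ∈ S → (fill fs P , x) ∈ S → (fill fs P′ , not x) ∈ S →
              Wins E S (bisect k fs P P′ a x)
bisect-wins {P = P} {a = a} {P′ = P′} {x = x} zero [] _ mP mP′ mx mx′ with x ≟ᵇ a
... | yes refl = refuteBoth-wins P′ mP′ mx′
... | no  x≢a  = refuteBoth-wins P mP (subst (λ b → (P , b) ∈ _) (¬-not x≢a) mx)
bisect-wins zero    (f ∷ [])    _ mP mP′ mx mx′ = askSide-wins f mP mP′ mx mx′
bisect-wins zero    (_ ∷ _ ∷ _) (s≤s ())
bisect-wins {P = P} {a = a} {S = S} {P′ = P′} {x = x} (suc k) fs len mP mP′ mx mx′ =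
  win-node (win-node (ys-wins false) (zs-wins false)) (win-node (zs-wins true) (ys-wins true))
  where
  ys = take (2 ^ k) fs
  zs = drop (2 ^ k) fs
  M  = fill zs P
  M′ = fill zs P′
  length-ys : length ys ≤ 2 ^ k
  length-ys = ≤-trans (≤-reflexive (length-take (2 ^ k) fs)) (m⊓n≤m _ _)
  2^[1+k]≡2^k+2^k : 2 ^ suc k ≡ 2 ^ k + 2 ^ k
  2^[1+k]≡2^k+2^k = cong (2 ^ k +_) (+-identityʳ (2 ^ k))
  length-zs : length zs ≤ 2 ^ k
  length-zs = subst (_≤ 2 ^ k) (sym (length-drop (2 ^ k) fs))
    (m≤n+o⇒m∸n≤o (length fs) (2 ^ k) (subst (length fs ≤_) 2^[1+k]≡2^k+2^k len))
  in-ys : ∀ {R b} → (fill fs R , b) ∈ S → (fill ys (fill zs R) , b) ∈ S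
  in-ys {R} {b} = subst (λ T → (T , b) ∈ S) (fill-take-drop (2 ^ k) fs R)
  ys-wins : ∀ u → Wins E ((M′ , u) ∷ (M , u) ∷ S) (bisect k ys M M′ u x)
  ys-wins u = bisect-wins k ys length-ys (there (here refl)) (here refl)
                (there (there (in-ys mx))) (there (there (in-ys mx′)))
  zs-wins : ∀ u → Wins E ((M′ , not u) ∷ (M , u) ∷ S) (bisect k zs P P′ a u)
  zs-wins u = bisect-wins k zs length-zs (there (there mP)) (there (there mP′))
                (there (here refl)) (here refl)

bisect-rounds : ∀ k (fs : List (Frame n)) P P′ a x → rounds (bisect k fs P P′ a x) ≤ 2 * (k + 1)
bisect-rounds zero [] P P′ a x with does (x ≟ᵇ a)
... | true  = refuteBoth-rounds P′
... | false = refuteBoth-rounds P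
bisect-rounds zero (f ∷ _) P P′ a x = m≤n⇒m≤1+n (askSide-rounds f)
bisect-rounds (suc k) fs P P′ a x = begin
  rounds (bisect (suc k) fs P P′ a x)  ≤⟨ s≤s (⊔-lub (s≤s (⊔-lub ih ih)) (s≤s (⊔-lub ih ih))) ⟩
  2 + 2 * (k + 1)                      ≡⟨ *-suc 2 (k + 1) ⟨
  2 * (suc k + 1)                      ∎
  where
  open ≤-Reasoning
  ih : ∀ {fs P P′ a x} → rounds (bisect k fs P P′ a x) ≤ 2 * (k + 1)
  ih = bisect-rounds k _ _ _ _ _

bisect-DM : ∀ k (fs : List (Frame n)) → IsDM (fill fs P) → IsDM (fill fs P′) →
            AllDM (bisect k fs P P′ a x)
bisect-DM {a = a} {x = x} zero [] d d′ with does (x ≟ᵇ a)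
... | true  = refuteBoth-DM d′
... | false = refuteBoth-DM d
bisect-DM zero    (f ∷ _) d _ = askSide-DM f d
bisect-DM {P = P} {P′ = P′} {a = a} {x = x} (suc k) fs d d′ =
  dm-node dM (dm-node dM′ ys-DM zs-DM) (dm-node dM′ zs-DM ys-DM)
  where
  ys = take (2 ^ k) fs
  zs = drop (2 ^ k) fs
  d-ys  = subst IsDM (fill-take-drop (2 ^ k) fs P) d
  d-ys′ = subst IsDM (fill-take-drop (2 ^ k) fs P′) d′
  dM  = IsDM-fill⁻ ys d-ys
  dM′ = IsDM-fill⁻ ys d-ys′
  ys-DM : ∀ {u} → AllDM (bisect k ys (fill zs P) (fill zs P′) u x)
  ys-DM = bisect-DM k ys d-ys d-ys′
  zs-DM : ∀ {u} → AllDM (bisect k zs P P′ a u)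
  zs-DM = bisect-DM k zs dM dM′

initState-wins : ∀ k (K : Ctx n) → length (frames K) ≤ 2 ^ k →
                 Wins E (initState P P′ K b c) (bisect k (frames K) P P′ b c)
initState-wins {P = P} {P′ = P′} {b = b} {c = c} k K len = bisect-wins k (frames K) len
  (here refl) (there (here refl))
  (in-frames P (there (there (here refl)))) (in-frames P′ (there (there (there (here refl)))))
  where
  in-frames : ∀ R {z} → (plug K R , z) ∈ initState P P′ K b c →
              (fill (frames K) R , z) ∈ initState P P′ K b c
  in-frames R {z} = subst (λ T → (T , z) ∈ _) (plug≡fill-frames K R)

lemma6p4 :
    (∃ λ (C : ℕ) → ∀ (n : ℕ) (E : Ext n) (P P′ X : Query n) (K : Ctx n) (b c : Bool) →
      Σ (Strategy n) λ t →
        Wins E (initState P P′ K b c) t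
        × rounds t ≤ C * (⌈log₂ depth (plug K X) ⌉ + 1))
    ×
    (∃ λ (C : ℕ) → ∀ (n : ℕ) (E : Ext n) (P P′ X : Query n) (K : Ctx n) (b c : Bool) →
      IsDM P → IsDM P′ → IsDM (plug K X) → IsDM (plug K P) → IsDM (plug K P′) →
      Σ (Strategy n) λ t →
        Wins E (initState P P′ K b c) t × AllDM t
        × rounds t ≤ C * (⌈log₂ depth (plug K X) ⌉ + 1))
lemma6p4 =
  (2 , λ n E P P′ X K b c →
    strategy K X P P′ b c , wins K X , bisect-rounds (k K X) (frames K) P P′ b c) ,
  (2 , λ n E P P′ X K b c _ _ _ dKP dKP′ →
    strategy K X P P′ b c , wins K X ,
    bisect-DM (k K X) (frames K) (IsDM-frames K dKP) (IsDM-frames K dKP′) ,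
    bisect-rounds (k K X) (frames K) P P′ b c)
  where
  k : Ctx n → Query n → ℕ
  k K X = ⌈log₂ depth (plug K X) ⌉
  strategy : Ctx n → Query n → Query n → Query n → Bool → Bool → Strategy n
  strategy K X = bisect (k K X) (frames K)
  wins : ∀ (K : Ctx n) X → Wins E (initState P P′ K b c) (strategy K X P P′ b c)
  wins K X = initState-wins (k K X) K (≤-trans (length-frames≤depth K X) (n≤2^⌈log₂n⌉ _))
  IsDM-frames : ∀ (K : Ctx n) → IsDM (plug K Q) → IsDM (fill (frames K) Q)
  IsDM-frames K = subst IsDM (plug≡fill-frames K _)
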